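{- Let $m\ge 1$ be an integer and $g=30m+2$. There exists an almost $5$-star factor $F$ on $\{0,1,\dots,30m+1\}$ with $t=2$ isolated vertices (so $F$ consists of $5m$ vertex-disjoint copies of $K_{1,5}$ together with an edge joining the two remaining vertices) such that: (i) every $d\in\{1,2,\dots,15m\}$ is the forward difference of at least one edge of $F$; (ii) every $d\in\{1,2,\dots,15m\}$ is the forward difference of at most two edges of $F$; (iii) $F$ has no wrap-around edges.
   Context: Let $g\ge 1$ and $t\in\{0,\dots,5\}$ with $g\equiv t\pmod 6$. An almost $5$-star factor on $\{0,1,\dots,g-1\}$ with $t$ isolated vertices is a graph $F$ on this vertex set such that the vertex set is partitioned into $(g-t)/6$ six-element sets, each spanning a connected component of $F$ isomorphic to $K_{1,5}$, and one $t$-element set $X$ (the isolated vertices) on which $F$ induces a star $K_{1,t-1}$ (for $t=2$, a single edge), and $F$ has no other edges. For an edge $\{u,w\}$ with $u<w$, its difference is $\min\{w-u,\,g-(w-u)\}$; the edge is a forward edge if its difference equals $w-u$ (and then $w-u$ is its forward difference), and a wrap-around edge otherwise. -}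

module Defs where

open import Data.Nat using (ℕ; zero; suc; _+_; _*_; _∸_; _⊓_; _⊔_; _≡ᵇ_)
open import Data.Bool using (Bool)
open import Data.Product using (_×_; _,_; proj₁; proj₂)
open import Data.List using (List; []; _∷_; _++_; map; concatMap; upTo; length; filterᵇ)
open import Data.Vec using (Vec; []; _∷_; toList)
open import Data.List.Relation.Binary.Permutation.Propositional using (_↭_)

-- An (undirected) edge {u,w}, stored as an unordered pair of endpoints.
Edge : Set
Edge = ℕ × ℕ

lowEnd highEnd : Edge → ℕ
lowEnd  (a , b) = a ⊓ b
highEnd (a , b) = a ⊔ b

span : Edge → ℕ
span e = highEnd e ∸ lowEnd e

difference : ℕ → Edge → ℕ
difference g e = span e ⊓ (g ∸ span e)

isForwardᵇ : ℕ → Edge → Bool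
isForwardᵇ g e = difference g e ≡ᵇ span e

hasForwardDiffᵇ : ℕ → ℕ → Edge → Bool
hasForwardDiffᵇ g d e with isForwardᵇ g e
... | Bool.true  = span e ≡ᵇ d
... | Bool.false = Bool.false

Star5 : Set
Star5 = ℕ × Vec ℕ 5

star5Vertices : Star5 → List ℕ
star5Vertices (c , ls) = c ∷ toList ls

star5Edges : Star5 → List Edge
star5Edges (c , ls) = map (λ l → (c , l)) (toList ls)

-- The star K_{1,t-1} induced on the t-element set X (first entry = centre);
-- no edges when t = 0.
isoEdges : ∀ {t} → Vec ℕ t → List Edge
isoEdges []       = []
isoEdges (c ∷ ls) = map (λ l → (c , l)) (toList ls)

record Almost5StarFactor (g t : ℕ) : Set where
  field
    stars     : List Star5
    isolated  : Vec ℕ t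
    partition : (concatMap star5Vertices stars ++ toList isolated) ↭ upTo g

  edges : List Edge
  edges = concatMap star5Edges stars ++ isoEdges isolated

open Almost5StarFactor public

forwardDiffCount : ∀ {g t} → Almost5StarFactor g t → ℕ → ℕ
forwardDiffCount {g} F d = length (filterᵇ (hasForwardDiffᵇ g d) (edges F))

{-# OPTIONS --safe #-}
-- Remove the vertices 15m and 30m + 1, which carry the isolated edge (span 15m + 1), and
-- cut the remaining ones into 30 blocks of m consecutive vertices.  In each of the m
-- layers (i , j), i + j + 1 = m, a copy of one fixed pattern of five stars on the 30
-- blocks is placed, every block contributing its i-th vertex counted upwards or its
-- j-th counted downwards.  If the ends of a pattern edge lie δ + 1 blocks apart, are read
-- in opposite directions and have offsets differing by e, its m copies have the spans
-- δm + e + 1, δm + e + 3, …, δm + e + 2m − 1.  The offsets e = 0 and e = 1 together fill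
-- (δm, (δ + 2)m] exactly once; the 25 pattern edges form 11 such pairs and 3 singles,
-- which cover each of the 15 intervals (km, (k + 1)m] once or twice.  No span exceeds
-- 15m + 1, so no edge wraps around.
module Submission where

open import Defs
open import Data.Bool using (Bool; true; false; T; not; if_then_else_)
import Data.Bool.Properties as Bool
open import Data.Empty using (⊥-elim)
open import Data.Fin using (toℕ; fromℕ<)
open import Data.Fin.Properties using (toℕ-fromℕ<) renaming (all? to allFin?)
open import Data.List using (List; []; _∷_; _++_; map; concatMap; applyUpTo; upTo; downFrom; length; filterᵇ)
open import Data.List.Properties
  using ( filter-++; length-++; map-∘; map-cong; map-cong-local; map-++; concatMap-map; map-concatMap
        ; concatMap-++; ++-assoc; reverse-upTo)
open import Data.List.Relation.Binary.Permutation.Propositional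
  using (_↭_; ↭-refl; ↭-sym; ↭-trans; ↭-reflexive; prep; module PermutationReasoning)
import Data.List.Relation.Binary.Permutation.Propositional as ↭
open import Data.List.Relation.Binary.Permutation.Propositional.Properties
  using (++⁺; ++⁺ˡ; ++⁺ʳ; shift; shifts; map⁺; ↭-length; ↭-reverse; filter-↭; All-resp-↭)
open import Data.List.Relation.Unary.All using (All; []; _∷_; all?)
import Data.List.Relation.Unary.All as All
import Data.List.Relation.Unary.All.Properties as All
import Data.List.Sort.InsertionSort.Base as InsertionSort
import Data.List.Sort.InsertionSort.Properties as InsertionSortProperties
open import Data.Nat using (ℕ; zero; suc; _+_; _*_; _∸_; _≤_; _<_; _≡ᵇ_; _≤?_; z≤n; s≤s; z<s; ∣_-_∣)
open import Data.Nat.ListAction using (sum)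
open import Data.Nat.Properties
open import Data.Nat.Tactic.RingSolver using (solve-∀)
open import Data.Product using (Σ; ∃; _×_; _,_; proj₁; proj₂)
open import Data.Product.Properties using (≡-dec)
open import Data.Product.Relation.Binary.Lex.NonStrict using (×-decTotalOrder)
open import Data.Sum using (_⊎_; inj₁; inj₂)
open import Data.Vec using (Vec; toList) renaming ([] to []ᵥ; _∷_ to _∷ᵥ_)
import Data.Vec as Vec
open import Function using (_∘_)
open import Relation.Binary.Bundles using (DecTotalOrder)
open import Relation.Binary.Definitions using (DecidableEquality; tri<; tri≈; tri>)
open import Relation.Binary.PropositionalEquality
open import Relation.Nullary using (Dec; yes; no)
open import Relation.Nullary.Decidable using (T?; dec-true; dec-false; from-yes; _×-dec_; _⊎-dec_)

private variable
  A B C : Set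

-- `does (m ≟ n)` computes to `m ≡ᵇ n`.
≡ᵇ-true : ∀ {m n} → m ≡ n → (m ≡ᵇ n) ≡ true
≡ᵇ-true {m} {n} = dec-true (m ≟ n)

≡ᵇ-false : ∀ {m n} → m ≢ n → (m ≡ᵇ n) ≡ false
≡ᵇ-false {m} {n} = dec-false (m ≟ n)

count : (A → Bool) → List A → ℕ
count p xs = length (filterᵇ p xs)

count-++ : ∀ (p : A → Bool) xs ys → count p (xs ++ ys) ≡ count p xs + count p ys
count-++ p xs ys = trans (cong length (filter-++ (T? ∘ p) xs ys)) (length-++ (filterᵇ p xs))

count-↭ : ∀ (p : A → Bool) {xs ys} → xs ↭ ys → count p xs ≡ count p ys
count-↭ p xs↭ys = ↭-length (filter-↭ (T? ∘ p) xs↭ys)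

count-concatMap : ∀ (p : B → Bool) (f : A → List B) xs →
                  count p (concatMap f xs) ≡ sum (map (count p ∘ f) xs)
count-concatMap p f []       = refl
count-concatMap p f (x ∷ xs) =
  trans (count-++ p (f x) (concatMap f xs)) (cong (count p (f x) +_) (count-concatMap p f xs))

multiplicity : ℕ → List ℕ → ℕ
multiplicity d = count (_≡ᵇ d)

multiplicity-here : ∀ d xs → multiplicity d (d ∷ xs) ≡ suc (multiplicity d xs)
multiplicity-here d xs rewrite ≡ᵇ-true {d} refl = refl

multiplicity-there : ∀ {x d} xs → x ≢ d → multiplicity d (x ∷ xs) ≡ multiplicity d xs
multiplicity-there xs x≢d rewrite ≡ᵇ-false x≢d = refl

sum-map-mono : ∀ {f g : A → ℕ} {xs} → All (λ x → f x ≤ g x) xs → sum (map f xs) ≤ sum (map g xs)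
sum-map-mono []         = z≤n
sum-map-mono (le ∷ les) = +-mono-≤ le (sum-map-mono les)

concatMap-concatMap : ∀ (f : B → List C) (g : A → List B) xs →
                      concatMap f (concatMap g xs) ≡ concatMap (concatMap f ∘ g) xs
concatMap-concatMap f g []       = refl
concatMap-concatMap f g (x ∷ xs) =
  trans (concatMap-++ f (g x) (concatMap g xs)) (cong (concatMap f (g x) ++_) (concatMap-concatMap f g xs))

concatMap-↭ : ∀ (f : A → List B) {xs ys} → xs ↭ ys → concatMap f xs ↭ concatMap f ys
concatMap-↭ f ↭.refl         = ↭-refl
concatMap-↭ f (↭.prep x p)   = ++⁺ˡ (f x) (concatMap-↭ f p)
concatMap-↭ f (↭.swap x y p) = ↭-trans (shifts (f x) (f y)) (++⁺ˡ (f y) (++⁺ˡ (f x) (concatMap-↭ f p)))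
concatMap-↭ f (↭.trans p q)  = ↭-trans (concatMap-↭ f p) (concatMap-↭ f q)

concatMap-↭-pointwise : ∀ {f g : A → List B} {xs} → All (λ x → f x ↭ g x) xs →
                        concatMap f xs ↭ concatMap g xs
concatMap-↭-pointwise []       = ↭-refl
concatMap-↭-pointwise (p ∷ ps) = ++⁺ p (concatMap-↭-pointwise ps)

concatMap-∷-↭ : ∀ (f : A → B) (g : A → List B) xs →
                concatMap (λ x → f x ∷ g x) xs ↭ map f xs ++ concatMap g xs
concatMap-∷-↭ f g []       = ↭-refl
concatMap-∷-↭ f g (x ∷ xs) =
  prep (f x) (↭-trans (++⁺ˡ (g x) (concatMap-∷-↭ f g xs)) (shifts (g x) (map f xs)))

concatMap-[] : ∀ (xs : List A) → concatMap {B = B} (λ _ → []) xs ≡ []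
concatMap-[] []       = refl
concatMap-[] (_ ∷ xs) = concatMap-[] xs

concatMap-map-comm : ∀ (f : A → B → C) xs ys →
                     concatMap (λ x → map (f x) ys) xs ↭ concatMap (λ y → map (λ x → f x y) xs) ys
concatMap-map-comm f []       ys = ↭-reflexive (sym (concatMap-[] ys))
concatMap-map-comm f (x ∷ xs) ys =
  ↭-trans (++⁺ˡ (map (f x) ys) (concatMap-map-comm f xs ys))
          (↭-sym (concatMap-∷-↭ (f x) (λ y → map (λ x′ → f x′ y) xs) ys))

module _ {a ℓ₁ ℓ₂} (O : DecTotalOrder a ℓ₁ ℓ₂) where
  open DecTotalOrder O using (Carrier)
  open InsertionSort O using (sort)
  open InsertionSortProperties O using (sort-↭)

  sort-≡⇒↭ : ∀ {xs ys : List Carrier} → sort xs ≡ sort ys → xs ↭ ys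
  sort-≡⇒↭ {xs} {ys} eq = ↭-trans (↭-sym (sort-↭ xs)) (↭-trans (↭-reflexive eq) (sort-↭ ys))

interval : ℕ → ℕ → List ℕ
interval o zero    = []
interval o (suc n) = o ∷ interval (suc o) n

applyUpTo-interval : ∀ (f : ℕ → ℕ) o n → (∀ t → f t ≡ o + t) → applyUpTo f n ≡ interval o n
applyUpTo-interval f o zero    f≗o+ = refl
applyUpTo-interval f o (suc n) f≗o+ =
  cong₂ _∷_ (trans (f≗o+ 0) (+-identityʳ o))
            (applyUpTo-interval (f ∘ suc) (suc o) n (λ t → trans (f≗o+ (suc t)) (+-suc o t)))

upTo≡interval : ∀ n → upTo n ≡ interval 0 n
upTo≡interval n = applyUpTo-interval (λ t → t) 0 n (λ _ → refl)

interval-++ : ∀ o a b → interval o (a + b) ≡ interval o a ++ interval (o + a) b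
interval-++ o zero    b = cong (λ o′ → interval o′ b) (sym (+-identityʳ o))
interval-++ o (suc a) b = cong (o ∷_) (trans (interval-++ (suc o) a b)
                                             (cong (λ o′ → interval (suc o) a ++ interval o′ b) (sym (+-suc o a))))

map-+-interval : ∀ x o n → map (x +_) (interval o n) ≡ interval (x + o) n
map-+-interval x o zero    = refl
map-+-interval x o (suc n) =
  cong (x + o ∷_) (trans (map-+-interval x (suc o) n) (cong (λ o′ → interval o′ n) (+-suc x o)))

map-+-interval₀ : ∀ x n → map (x +_) (interval 0 n) ≡ interval x n
map-+-interval₀ x n = trans (map-+-interval x 0 n) (cong (λ o → interval o n) (+-identityʳ x))

downFrom↭interval : ∀ n → downFrom n ↭ interval 0 n
downFrom↭interval n =
  ↭-trans (↭-reflexive (sym (reverse-upTo n))) (↭-trans (↭-reverse (upTo n)) (↭-reflexive (upTo≡interval n)))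

multiplicity-interval-∉ : ∀ {d} o n → d < o ⊎ o + n ≤ d → multiplicity d (interval o n) ≡ 0
multiplicity-interval-∉ o zero    _ = refl
multiplicity-interval-∉ o (suc n) (inj₁ d<o) =
  trans (multiplicity-there (interval (suc o) n) (λ o≡d → <-irrefl (sym o≡d) d<o))
        (multiplicity-interval-∉ (suc o) n (inj₁ (m<n⇒m<1+n d<o)))
multiplicity-interval-∉ {d} o (suc n) (inj₂ o+n≤d) =
  trans (multiplicity-there (interval (suc o) n) (λ o≡d → <-irrefl o≡d (<-≤-trans (m<m+n o z<s) o+n≤d)))
        (multiplicity-interval-∉ (suc o) n (inj₂ (subst (_≤ d) (+-suc o n) o+n≤d)))

multiplicity-interval-∈ : ∀ {d} o n → o ≤ d → d < o + n → multiplicity d (interval o n) ≡ 1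
multiplicity-interval-∈ {d} o zero    o≤d d<o+0 = ⊥-elim (≤⇒≯ o≤d (subst (d <_) (+-identityʳ o) d<o+0))
multiplicity-interval-∈ {d} o (suc n) o≤d d<o+n with o ≟ d
... | yes refl = trans (multiplicity-here o _) (cong suc (multiplicity-interval-∉ (suc o) n (inj₁ (n<1+n o))))
... | no o≢d   = trans (multiplicity-there (interval (suc o) n) o≢d)
                       (multiplicity-interval-∈ (suc o) n (≤∧≢⇒< o≤d o≢d) (subst (d <_) (+-suc o n) d<o+n))

interval-halves-with-gaps : ∀ n → interval 0 n ++ interval (n + 1) n ++ n ∷ suc (n + n) ∷ []
                        ↭ interval 0 (n + suc (n + 1))
interval-halves-with-gaps n = begin
  interval 0 n ++ interval (n + 1) n ++ n ∷ suc (n + n) ∷ []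
    ≡⟨ cong (λ o → interval 0 n ++ interval o n ++ n ∷ suc (n + n) ∷ []) (+-comm n 1) ⟩
  interval 0 n ++ interval (suc n) n ++ n ∷ suc (n + n) ∷ []
    ↭⟨ ++⁺ˡ (interval 0 n) (shift n (interval (suc n) n) (suc (n + n) ∷ [])) ⟩
  interval 0 n ++ n ∷ interval (suc n) n ++ suc (n + n) ∷ []
    ≡⟨ cong (λ xs → interval 0 n ++ n ∷ xs) (sym (interval-++ (suc n) n 1)) ⟩
  interval 0 n ++ interval n (suc (n + 1))
    ≡⟨ sym (interval-++ 0 n (suc (n + 1))) ⟩
  interval 0 (n + suc (n + 1)) ∎
  where open PermutationReasoning

progression : ℕ → ℕ → List ℕ
progression K zero    = []
progression K (suc k) = K ∷ progression (2 + K) k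

map-affine-interval : ∀ K o k → map (λ t → K + 2 * t) (interval o k) ≡ progression (K + 2 * o) k
map-affine-interval K o zero    = refl
map-affine-interval K o (suc k) =
  cong (K + 2 * o ∷_) (trans (map-affine-interval K (suc o) k) (cong (λ x → progression x k) (step K o)))
  where
  step : ∀ K o → K + 2 * suc o ≡ 2 + (K + 2 * o)
  step = solve-∀

map-affine-interval₀ : ∀ K n → map (λ t → K + 2 * t) (interval 0 n) ≡ progression K n
map-affine-interval₀ K n = trans (map-affine-interval K 0 n) (cong (λ x → progression x n) (+-identityʳ K))

progression-interleave : ∀ K k → progression K k ++ progression (suc K) k ↭ interval K (k + k)
progression-interleave K zero    = ↭-refl
progression-interleave K (suc k) = begin
  K ∷ progression (2 + K) k ++ suc K ∷ progression (3 + K) k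
    ↭⟨ prep K (shift (suc K) (progression (2 + K) k) _) ⟩
  K ∷ suc K ∷ progression (2 + K) k ++ progression (3 + K) k
    ↭⟨ prep K (prep (suc K) (progression-interleave (2 + K) k)) ⟩
  K ∷ suc K ∷ interval (2 + K) (k + k)
    ≡⟨ cong (λ n → K ∷ interval (suc K) n) (sym (+-suc k k)) ⟩
  interval K (suc k + suc k) ∎
  where open PermutationReasoning

progression-< : ∀ K k → All (_< K + 2 * k) (progression K k)
progression-< K zero    = []
progression-< K (suc k) =
  m<m+n K z<s ∷ All.map (λ x< → <-≤-trans x< (≤-reflexive (step K k))) (progression-< (2 + K) k)
  where
  step : ∀ K k → 2 + K + 2 * k ≡ K + 2 * suc k
  step = solve-∀

antidiagonal : ℕ → ℕ → List (ℕ × ℕ)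
antidiagonal o zero    = []
antidiagonal o (suc k) = (o , k) ∷ antidiagonal (suc o) k

proj₁-antidiagonal : ∀ o k → map proj₁ (antidiagonal o k) ≡ interval o k
proj₁-antidiagonal o zero    = refl
proj₁-antidiagonal o (suc k) = cong (o ∷_) (proj₁-antidiagonal (suc o) k)

proj₂-antidiagonal : ∀ o k → map proj₂ (antidiagonal o k) ≡ downFrom k
proj₂-antidiagonal o zero    = refl
proj₂-antidiagonal o (suc k) = cong (k ∷_) (proj₂-antidiagonal (suc o) k)

antidiagonal-sum : ∀ o k → All (λ (i , j) → suc (i + j) ≡ o + k) (antidiagonal o k)
antidiagonal-sum o zero    = []
antidiagonal-sum o (suc k) =
  sym (+-suc o k) ∷ All.map (λ eq → trans eq (sym (+-suc o k))) (antidiagonal-sum (suc o) k)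

map-proj₁-antidiagonal : ∀ (f : ℕ → A) n → map (f ∘ proj₁) (antidiagonal 0 n) ≡ map f (interval 0 n)
map-proj₁-antidiagonal f n = trans (map-∘ (antidiagonal 0 n)) (cong (map f) (proj₁-antidiagonal 0 n))

map-proj₂-antidiagonal : ∀ (f : ℕ → A) n → map (f ∘ proj₂) (antidiagonal 0 n) ↭ map f (interval 0 n)
map-proj₂-antidiagonal f n =
  ↭-trans (↭-reflexive (trans (map-∘ (antidiagonal 0 n)) (cong (map f) (proj₂-antidiagonal 0 n))))
          (map⁺ f (downFrom↭interval n))

span-comm : ∀ x y → span (x , y) ≡ span (y , x)
span-comm x y = cong₂ _∸_ (⊔-comm x y) (⊓-comm x y)

span-+ : ∀ x s {y} → x + s ≡ y → span (x , y) ≡ s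
span-+ x s refl = trans (cong₂ _∸_ (m≤n⇒m⊔n≡n (m≤m+n x s)) (m≤n⇒m⊓n≡m (m≤m+n x s))) (m+n∸m≡n x s)

layer-span : ∀ a o δ e {i j n} → suc (i + j) ≡ n →
             span (a * n + o + j , (a + suc δ) * n + (o + e) + i) ≡ e + suc (δ * n) + 2 * i
layer-span a o δ e {i} {j} {n} i+j =
  span-+ (a * n + o + j) _
    (subst (λ n → a * n + o + j + (e + suc (δ * n) + 2 * i) ≡ (a + suc δ) * n + (o + e) + i)
           i+j (identity a o δ e i j))
  where
  identity : ∀ a o δ e i j → a * suc (i + j) + o + j + (e + suc (δ * suc (i + j)) + 2 * i)
                             ≡ (a + suc δ) * suc (i + j) + (o + e) + i
  identity = solve-∀

span+span≤⇒isForward : ∀ g e → span e + span e ≤ g → T (isForwardᵇ g e)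
span+span≤⇒isForward g e short rewrite m≤n⇒m⊓n≡m (m+n≤o⇒m≤o∸n (span e) short) = ≡⇒≡ᵇ (span e) (span e) refl

count-hasForwardDiff : ∀ g d {es} → All (T ∘ isForwardᵇ g) es →
                       count (hasForwardDiffᵇ g d) es ≡ multiplicity d (map span es)
count-hasForwardDiff g d []                  = refl
count-hasForwardDiff g d {e ∷ _} (fw ∷ fws) with isForwardᵇ g e
... | true with span e ≡ᵇ d
...   | true  = cong suc (count-hasForwardDiff g d fws)
...   | false = count-hasForwardDiff g d fws

-- The slot (a , o , ascending) is block a, the vertices a·m + o, …, a·m + o + m − 1, read
-- upwards or downwards: in layer (i , j) it contributes its i-th, resp. its j-th, vertex.
Slot : Set
Slot = ℕ × ℕ × Bool

_≟ˢ_ : DecidableEquality Slot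
_≟ˢ_ = ≡-dec _≟_ (≡-dec _≟_ Bool._≟_)

Class : Set
Class = ℕ × ℕ

shift-slot : Class → Slot → Slot
shift-slot (δ , e) (a , o , ascending) = (a + suc δ , o + e , not ascending)

classOf : Slot × Slot → Class
classOf ((a , o , _) , (b , o′ , _)) = (∣ a - b ∣ ∸ 1 , ∣ o - o′ ∣)

Adjacent : Class → Slot → Slot → Set
Adjacent κ s t = t ≡ shift-slot κ s ⊎ s ≡ shift-slot κ t

adjacent? : ∀ κ s t → Dec (Adjacent κ s t)
adjacent? κ s t = (t ≟ˢ shift-slot κ s) ⊎-dec (s ≟ˢ shift-slot κ t)

starPattern : List (Slot × Vec Slot 5)
starPattern =
    ((11 , 0 , true)  , (0 , 0 , false) ∷ᵥ (1 , 0 , false) ∷ᵥ (2 , 0 , false) ∷ᵥ (3 , 0 , false) ∷ᵥ (4 , 0 , false) ∷ᵥ []ᵥ)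
  ∷ ((18 , 1 , false) , (5 , 0 , true) ∷ᵥ (6 , 0 , true) ∷ᵥ (7 , 0 , true) ∷ᵥ (8 , 0 , true) ∷ᵥ (9 , 0 , true) ∷ᵥ []ᵥ)
  ∷ ((15 , 1 , true)  , (10 , 0 , false) ∷ᵥ (12 , 0 , false) ∷ᵥ (14 , 0 , false) ∷ᵥ (28 , 1 , false) ∷ᵥ (29 , 1 , false) ∷ᵥ []ᵥ)
  ∷ ((13 , 0 , true)  , (17 , 1 , false) ∷ᵥ (19 , 1 , false) ∷ᵥ (20 , 1 , false) ∷ᵥ (21 , 1 , false) ∷ᵥ (27 , 1 , false) ∷ᵥ []ᵥ)
  ∷ ((22 , 1 , false) , (16 , 1 , true) ∷ᵥ (23 , 1 , true) ∷ᵥ (24 , 1 , true) ∷ᵥ (25 , 1 , true) ∷ᵥ (26 , 1 , true) ∷ᵥ []ᵥ)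
  ∷ []

patternSlots : List Slot
patternSlots = concatMap (λ (c , ls) → c ∷ toList ls) starPattern

patternEdges : List (Slot × Slot)
patternEdges = concatMap (λ (c , ls) → map (c ,_) (toList ls)) starPattern

ℕ²-lex : DecTotalOrder _ _ _
ℕ²-lex = ×-decTotalOrder ≤-decTotalOrder ≤-decTotalOrder

blockOf : Slot → ℕ × ℕ
blockOf (a , o , _) = (a , o)

blockRun : ℕ → ℕ → ℕ → List (ℕ × ℕ)
blockRun e c zero    = []
blockRun e c (suc k) = (c , e) ∷ blockRun e (suc c) k

-- Both sides of these permutations sort to the same list.
patternSlots-blocks : map blockOf patternSlots ↭ blockRun 0 0 15 ++ blockRun 1 15 15
patternSlots-blocks = sort-≡⇒↭ ℕ²-lex refl

patternEdges-adjacent : All (λ ℓ → Adjacent (classOf ℓ) (proj₁ ℓ) (proj₂ ℓ)) patternEdges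
patternEdges-adjacent = from-yes (all? (λ (s , t) → adjacent? (classOf (s , t)) s t) patternEdges)

-- For δ in paired both offsets occur, and their spans fill (δm, (δ + 2)m]; coverage δ k
-- counts how often this covers (km, (k + 1)m].
bothOffsets : ℕ → List Class
bothOffsets δ = (δ , 0) ∷ (δ , 1) ∷ []

paired : List ℕ
paired = 0 ∷ 2 ∷ 3 ∷ 5 ∷ 6 ∷ 7 ∷ 8 ∷ 9 ∷ 10 ∷ 12 ∷ 13 ∷ []

singles : List Class
singles = (1 , 0) ∷ (4 , 1) ∷ (11 , 1) ∷ []

patternClasses : map classOf patternEdges ↭ concatMap bothOffsets paired ++ singles
patternClasses = sort-≡⇒↭ ℕ²-lex refl

patternClasses-bounded : All (λ (δ , e) → δ ≤ 13 × e ≤ 1) (map classOf patternEdges)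
patternClasses-bounded = from-yes (all? (λ (δ , e) → (δ ≤? 13) ×-dec (e ≤? 1)) (map classOf patternEdges))

singles-offsets : All (λ (_ , e) → e ≤ 1) singles
singles-offsets =
  All.map proj₂ (All.++⁻ʳ (concatMap bothOffsets paired) (All-resp-↭ patternClasses patternClasses-bounded))

indicator : ℕ → ℕ → ℕ
indicator c k = if c ≡ᵇ k then 1 else 0

coverage : ℕ → ℕ → ℕ
coverage δ k = indicator δ k + indicator (suc δ) k

pairedCoverage singlesCoverage : ℕ → ℕ
pairedCoverage  k = sum (map (λ δ → coverage δ k) paired)
singlesCoverage k = sum (map (λ (δ , _) → coverage δ k) singles)

WellCovered : ℕ → Set
WellCovered k = 1 ≤ pairedCoverage k × pairedCoverage k + singlesCoverage k ≤ 2

wellCovered? : ∀ k → Dec (WellCovered k)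
wellCovered? k = (1 ≤? pairedCoverage k) ×-dec (pairedCoverage k + singlesCoverage k ≤? 2)

wellCovered : ∀ {k} → k < 15 → WellCovered k
wellCovered k<15 =
  subst WellCovered (toℕ-fromℕ< k<15) (from-yes (allFin? {n = 15} (wellCovered? ∘ toℕ)) (fromℕ< k<15))

module StarFactor (m : ℕ) where

  layers : List (ℕ × ℕ)
  layers = antidiagonal 0 m

  vertex : Slot → ℕ × ℕ → ℕ
  vertex (a , o , true)  (i , _) = a * m + o + i
  vertex (a , o , false) (_ , j) = a * m + o + j

  edgeAt : Slot × Slot → ℕ × ℕ → Edge
  edgeAt (s , t) p = (vertex s p , vertex t p)

  block : ℕ × ℕ → List ℕ
  block (a , o) = interval (a * m + o) m

  vertex-block : ∀ s → map (vertex s) layers ↭ block (blockOf s)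
  vertex-block (a , o , true)  =
    ↭-reflexive (trans (map-proj₁-antidiagonal (a * m + o +_) m) (map-+-interval₀ (a * m + o) m))
  vertex-block (a , o , false) =
    ↭-trans (map-proj₂-antidiagonal (a * m + o +_) m) (↭-reflexive (map-+-interval₀ (a * m + o) m))

  blocks-consecutive : ∀ e c k → concatMap block (blockRun e c k) ≡ interval (c * m + e) (k * m)
  blocks-consecutive e c zero    = refl
  blocks-consecutive e c (suc k) = begin
    block (c , e) ++ concatMap block (blockRun e (suc c) k)
      ≡⟨ cong (block (c , e) ++_) (blocks-consecutive e (suc c) k) ⟩
    interval (c * m + e) m ++ interval (suc c * m + e) (k * m)
      ≡⟨ cong (λ o → interval (c * m + e) m ++ interval o (k * m)) (next-block c e m) ⟩
    interval (c * m + e) m ++ interval (c * m + e + m) (k * m)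
      ≡⟨ sym (interval-++ (c * m + e) m (k * m)) ⟩
    interval (c * m + e) (suc k * m) ∎
    where
    open ≡-Reasoning
    next-block : ∀ c e m → suc c * m + e ≡ c * m + e + m
    next-block = solve-∀

  classSpans : Class → List ℕ
  classSpans (δ , e) = progression (e + suc (δ * m)) m

  spans-shift : ∀ κ s → map (span ∘ edgeAt (s , shift-slot κ s)) layers ↭ classSpans κ
  spans-shift (δ , e) (a , o , false) = ↭-reflexive (begin
    map (span ∘ edgeAt ((a , o , false) , (a + suc δ , o + e , true))) layers
      ≡⟨ map-cong-local (All.map (layer-span a o δ e) (antidiagonal-sum 0 m)) ⟩
    map ((λ t → e + suc (δ * m) + 2 * t) ∘ proj₁) layers
      ≡⟨ map-proj₁-antidiagonal _ m ⟩
    map (λ t → e + suc (δ * m) + 2 * t) (interval 0 m)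
      ≡⟨ map-affine-interval₀ _ m ⟩
    progression (e + suc (δ * m)) m ∎)
    where open ≡-Reasoning
  spans-shift (δ , e) (a , o , true) = begin
    map (span ∘ edgeAt ((a , o , true) , (a + suc δ , o + e , false))) layers
      ≡⟨ map-cong-local (All.map (λ {(i , j)} i+j → layer-span a o δ e (trans (cong suc (+-comm j i)) i+j))
                                 (antidiagonal-sum 0 m)) ⟩
    map ((λ t → e + suc (δ * m) + 2 * t) ∘ proj₂) layers
      ↭⟨ map-proj₂-antidiagonal _ m ⟩
    map (λ t → e + suc (δ * m) + 2 * t) (interval 0 m)
      ≡⟨ map-affine-interval₀ _ m ⟩
    progression (e + suc (δ * m)) m ∎
    where open PermutationReasoning

  spans-adjacent : ∀ κ s t → Adjacent κ s t → map (span ∘ edgeAt (s , t)) layers ↭ classSpans κ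
  spans-adjacent κ s _ (inj₁ refl) = spans-shift κ s
  spans-adjacent κ _ t (inj₂ refl) =
    ↭-trans (↭-reflexive (map-cong (λ p → span-comm (vertex (shift-slot κ t) p) (vertex t p)) layers))
            (spans-shift κ t)

  pairSpans : ℕ → List ℕ
  pairSpans δ = classSpans (δ , 0) ++ classSpans (δ , 1)

  concatMap-bothOffsets : ∀ δs → concatMap classSpans (concatMap bothOffsets δs) ≡ concatMap pairSpans δs
  concatMap-bothOffsets []       = refl
  concatMap-bothOffsets (δ ∷ δs) =
    trans (sym (++-assoc (classSpans (δ , 0)) (classSpans (δ , 1)) _))
          (cong (pairSpans δ ++_) (concatMap-bothOffsets δs))

  unit : ℕ → List ℕ
  unit c = interval (suc (c * m)) m

  pairSpans↭units : ∀ δ → pairSpans δ ↭ unit δ ++ unit (suc δ)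
  pairSpans↭units δ = ↭-trans (progression-interleave (suc (δ * m)) m) (↭-reflexive (begin
    interval (suc (δ * m)) (m + m)
      ≡⟨ interval-++ (suc (δ * m)) m m ⟩
    unit δ ++ interval (suc (δ * m + m)) m
      ≡⟨ cong (λ o → unit δ ++ interval (suc o) m) (+-comm (δ * m) m) ⟩
    unit δ ++ unit (suc δ) ∎))
    where open ≡-Reasoning

  multiplicity-unit : ∀ {k d} c → k * m < d → d ≤ k * m + m → multiplicity d (unit c) ≡ indicator c k
  multiplicity-unit {k} {d} c lo hi with <-cmp c k
  ... | tri< c<k _ _ rewrite ≡ᵇ-false (<⇒≢ c<k) =
    multiplicity-interval-∉ (suc (c * m)) m
      (inj₂ (≤-<-trans (≤-trans (≤-reflexive (+-comm (c * m) m)) (*-monoˡ-≤ m c<k)) lo))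
  ... | tri≈ _ refl _ rewrite ≡ᵇ-true {c} refl = multiplicity-interval-∈ (suc (c * m)) m lo (s≤s hi)
  ... | tri> _ _ k<c rewrite ≡ᵇ-false (>⇒≢ k<c) =
    multiplicity-interval-∉ (suc (c * m)) m
      (inj₁ (s≤s (≤-trans hi (≤-trans (≤-reflexive (+-comm (k * m) m)) (*-monoˡ-≤ m k<c)))))

  multiplicity-pairSpans : ∀ {k d} δ → k * m < d → d ≤ k * m + m → multiplicity d (pairSpans δ) ≡ coverage δ k
  multiplicity-pairSpans {k} {d} δ lo hi = begin
    multiplicity d (pairSpans δ)                              ≡⟨ count-↭ _ (pairSpans↭units δ) ⟩
    multiplicity d (unit δ ++ unit (suc δ))                   ≡⟨ count-++ _ (unit δ) (unit (suc δ)) ⟩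
    multiplicity d (unit δ) + multiplicity d (unit (suc δ))   ≡⟨ cong₂ _+_ (multiplicity-unit {k} δ lo hi)
                                                                           (multiplicity-unit {k} (suc δ) lo hi) ⟩
    coverage δ k                                              ∎
    where open ≡-Reasoning

  multiplicity-classSpans : ∀ {k d} δ e → e ≤ 1 → k * m < d → d ≤ k * m + m →
                            multiplicity d (classSpans (δ , e)) ≤ coverage δ k
  multiplicity-classSpans δ e e≤1 lo hi =
    ≤-trans (part e e≤1)
            (≤-reflexive (trans (sym (count-++ _ (classSpans (δ , 0)) _)) (multiplicity-pairSpans δ lo hi)))
    where
    part : ∀ {d} e → e ≤ 1 → multiplicity d (classSpans (δ , e))
                             ≤ multiplicity d (classSpans (δ , 0)) + multiplicity d (classSpans (δ , 1))
    part 0 _                   = m≤m+n _ _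
    part 1 _                   = m≤n+m _ _
    part (suc (suc _)) (s≤s ())

  placeStar : Slot × Vec Slot 5 → ℕ × ℕ → Star5
  placeStar (c , ls) p = (vertex c p , Vec.map (λ s → vertex s p) ls)

  layeredStars : List Star5
  layeredStars = concatMap (λ p → map (λ st → placeStar st p) starPattern) layers

  n : ℕ
  n = 15 * m

  -- Blocks 0–14 have offset 0 and blocks 15–29 offset 1, which leaves n and 2n + 1 free.
  isolatedVertices : Vec ℕ 2
  isolatedVertices = n ∷ᵥ suc (n + n) ∷ᵥ []ᵥ

  star-vertices : concatMap star5Vertices layeredStars ↭ interval 0 n ++ interval (n + 1) n
  star-vertices = begin
    concatMap star5Vertices layeredStars
      ≡⟨ concatMap-concatMap star5Vertices _ layers ⟩
    concatMap (λ p → map (λ s → vertex s p) patternSlots) layers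
      ↭⟨ concatMap-map-comm (λ p s → vertex s p) layers patternSlots ⟩
    concatMap (λ s → map (vertex s) layers) patternSlots
      ↭⟨ concatMap-↭-pointwise (All.universal vertex-block patternSlots) ⟩
    concatMap (block ∘ blockOf) patternSlots
      ≡⟨ sym (concatMap-map block blockOf patternSlots) ⟩
    concatMap block (map blockOf patternSlots)
      ↭⟨ concatMap-↭ block patternSlots-blocks ⟩
    concatMap block (blockRun 0 0 15 ++ blockRun 1 15 15)
      ≡⟨ concatMap-++ block (blockRun 0 0 15) (blockRun 1 15 15) ⟩
    concatMap block (blockRun 0 0 15) ++ concatMap block (blockRun 1 15 15)
      ≡⟨ cong₂ _++_ (blocks-consecutive 0 0 15) (blocks-consecutive 1 15 15) ⟩
    interval 0 n ++ interval (n + 1) n ∎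
    where open PermutationReasoning

  vertices-partition : concatMap star5Vertices layeredStars ++ toList isolatedVertices ↭ upTo (30 * m + 2)
  vertices-partition = begin
    concatMap star5Vertices layeredStars ++ n ∷ suc (n + n) ∷ []
      ↭⟨ ++⁺ʳ _ star-vertices ⟩
    (interval 0 n ++ interval (n + 1) n) ++ n ∷ suc (n + n) ∷ []
      ≡⟨ ++-assoc (interval 0 n) _ _ ⟩
    interval 0 n ++ interval (n + 1) n ++ n ∷ suc (n + n) ∷ []
      ↭⟨ interval-halves-with-gaps n ⟩
    interval 0 (n + suc (n + 1))
      ≡⟨ cong (interval 0) (size m) ⟨
    interval 0 (30 * m + 2)
      ≡⟨ upTo≡interval (30 * m + 2) ⟨
    upTo (30 * m + 2) ∎
    where
    open PermutationReasoning
    size : ∀ m → 30 * m + 2 ≡ 15 * m + suc (15 * m + 1)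
    size = solve-∀

  F : Almost5StarFactor (30 * m + 2) 2
  F = record { stars = layeredStars ; isolated = isolatedVertices ; partition = vertices-partition }

  patternEdge-spans : All (λ ℓ → map span (map (edgeAt ℓ) layers) ↭ classSpans (classOf ℓ)) patternEdges
  patternEdge-spans = All.map (λ {ℓ} adj → ↭-trans (↭-reflexive (sym (map-∘ {g = span} {f = edgeAt ℓ} layers)))
                                                   (spans-adjacent (classOf ℓ) (proj₁ ℓ) (proj₂ ℓ) adj))
                              patternEdges-adjacent

  star-spans : map span (concatMap star5Edges layeredStars) ↭ concatMap classSpans (map classOf patternEdges)
  star-spans = begin
    map span (concatMap star5Edges layeredStars)
      ≡⟨ cong (map span) (concatMap-concatMap star5Edges _ layers) ⟩
    map span (concatMap (λ p → map (λ ℓ → edgeAt ℓ p) patternEdges) layers)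
      ↭⟨ map⁺ span (concatMap-map-comm (λ p ℓ → edgeAt ℓ p) layers patternEdges) ⟩
    map span (concatMap (λ ℓ → map (edgeAt ℓ) layers) patternEdges)
      ≡⟨ map-concatMap span (λ ℓ → map (edgeAt ℓ) layers) patternEdges ⟩
    concatMap (λ ℓ → map span (map (edgeAt ℓ) layers)) patternEdges
      ↭⟨ concatMap-↭-pointwise patternEdge-spans ⟩
    concatMap (classSpans ∘ classOf) patternEdges
      ≡⟨ concatMap-map classSpans classOf patternEdges ⟨
    concatMap classSpans (map classOf patternEdges) ∎
    where open PermutationReasoning

  classSpans-split : concatMap classSpans (map classOf patternEdges)
                     ↭ concatMap pairSpans paired ++ concatMap classSpans singles
  classSpans-split = ↭-trans (concatMap-↭ classSpans patternClasses) (↭-reflexive (begin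
    concatMap classSpans (concatMap bothOffsets paired ++ singles)
      ≡⟨ concatMap-++ classSpans (concatMap bothOffsets paired) singles ⟩
    concatMap classSpans (concatMap bothOffsets paired) ++ concatMap classSpans singles
      ≡⟨ cong (_++ concatMap classSpans singles) (concatMap-bothOffsets paired) ⟩
    concatMap pairSpans paired ++ concatMap classSpans singles ∎))
    where open ≡-Reasoning

  edge-spans : map span (edges F) ↭ concatMap classSpans (map classOf patternEdges) ++ suc n ∷ []
  edge-spans = begin
    map span (concatMap star5Edges layeredStars ++ (n , suc (n + n)) ∷ [])
      ≡⟨ map-++ span (concatMap star5Edges layeredStars) ((n , suc (n + n)) ∷ []) ⟩
    map span (concatMap star5Edges layeredStars) ++ span (n , suc (n + n)) ∷ []
      ↭⟨ ++⁺ star-spans (↭-reflexive (cong (_∷ []) (span-+ n (suc n) (+-suc n n)))) ⟩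
    concatMap classSpans (map classOf patternEdges) ++ suc n ∷ [] ∎
    where open PermutationReasoning

  classSpans-≤ : ∀ {δ e} → δ ≤ 13 → e ≤ 1 → All (_≤ suc n) (classSpans (δ , e))
  classSpans-≤ {δ} {e} δ≤13 e≤1 =
    All.map (λ x< → ≤-pred (<-≤-trans x< last)) (progression-< (e + suc (δ * m)) m)
    where
    total : ∀ m → 1 + suc (13 * m) + 2 * m ≡ 2 + 15 * m
    total = solve-∀
    last : e + suc (δ * m) + 2 * m ≤ 2 + n
    last = ≤-trans (+-monoˡ-≤ (2 * m) (+-mono-≤ e≤1 (s≤s (*-monoˡ-≤ m δ≤13)))) (≤-reflexive (total m))

  all-forward : All (T ∘ isForwardᵇ (30 * m + 2)) (edges F)
  all-forward = All.map (λ {e} short → span+span≤⇒isForward _ e (doubled short)) (All.map⁻ spans-short)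
    where
    total : ∀ m → suc (15 * m) + suc (15 * m) ≡ 30 * m + 2
    total = solve-∀
    doubled : ∀ {s} → s ≤ suc n → s + s ≤ 30 * m + 2
    doubled s≤ = ≤-trans (+-mono-≤ s≤ s≤) (≤-reflexive (total m))
    spans-short : All (_≤ suc n) (map span (edges F))
    spans-short = All-resp-↭ (↭-sym edge-spans)
      (All.++⁺ (All.concat⁺ (All.map⁺ (All.map (λ (δ≤13 , e≤1) → classSpans-≤ δ≤13 e≤1) patternClasses-bounded)))
               (≤-refl ∷ []))

  forwardDiffCount-formula : ∀ {k d} → k * m < d → d ≤ k * m + m → d ≤ n →
                             forwardDiffCount F d ≡ pairedCoverage k + multiplicity d (concatMap classSpans singles)
  forwardDiffCount-formula {k} {d} lo hi d≤n = begin
    forwardDiffCount F d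
      ≡⟨ count-hasForwardDiff (30 * m + 2) d all-forward ⟩
    multiplicity d (map span (edges F))
      ≡⟨ count-↭ _ (↭-trans edge-spans (++⁺ʳ (suc n ∷ []) classSpans-split)) ⟩
    multiplicity d ((P ++ S) ++ suc n ∷ [])
      ≡⟨ count-++ _ (P ++ S) (suc n ∷ []) ⟩
    multiplicity d (P ++ S) + multiplicity d (suc n ∷ [])
      ≡⟨ cong₂ _+_ (count-++ _ P S) (multiplicity-there [] (>⇒≢ (s≤s d≤n))) ⟩
    multiplicity d P + multiplicity d S + 0
      ≡⟨ +-identityʳ _ ⟩
    multiplicity d P + multiplicity d S
      ≡⟨ cong (_+ multiplicity d S) (count-concatMap _ pairSpans paired) ⟩
    sum (map (multiplicity d ∘ pairSpans) paired) + multiplicity d S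
      ≡⟨ cong (λ xs → sum xs + multiplicity d S) (map-cong (λ δ → multiplicity-pairSpans {k} δ lo hi) paired) ⟩
    pairedCoverage k + multiplicity d S ∎
    where
    open ≡-Reasoning
    P S : List ℕ
    P = concatMap pairSpans paired
    S = concatMap classSpans singles

  multiplicity-singles : ∀ {k d} → k * m < d → d ≤ k * m + m →
                         multiplicity d (concatMap classSpans singles) ≤ singlesCoverage k
  multiplicity-singles {k} lo hi =
    ≤-trans (≤-reflexive (count-concatMap _ classSpans singles))
            (sum-map-mono (All.map (λ {(δ , e)} e≤1 → multiplicity-classSpans {k} δ e e≤1 lo hi) singles-offsets))

  enclosingUnit : ∀ K {d} → 1 ≤ d → d ≤ K * m → ∃ λ k → k < K × k * m < d × d ≤ k * m + m
  enclosingUnit zero    1≤d d≤0 = ⊥-elim (≤⇒≯ d≤0 1≤d)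
  enclosingUnit (suc K) {d} 1≤d d≤ with d ≤? K * m
  ... | yes d≤Km = let k , k<K , lo , hi = enclosingUnit K 1≤d d≤Km in k , m<n⇒m<1+n k<K , lo , hi
  ... | no d≰Km  = K , n<1+n K , ≰⇒> d≰Km , ≤-trans d≤ (≤-reflexive (+-comm m (K * m)))

  forwardDiffCount-bounds : ∀ {d} → 1 ≤ d → d ≤ n → 1 ≤ forwardDiffCount F d × forwardDiffCount F d ≤ 2
  forwardDiffCount-bounds 1≤d d≤n =
    let k , k<15 , lo , hi     = enclosingUnit 15 1≤d d≤n
        covered , atMostTwice = wellCovered k<15
        formula               = forwardDiffCount-formula {k} lo hi d≤n
    in ≤-trans covered (≤-trans (m≤m+n _ _) (≤-reflexive (sym formula)))
     , ≤-trans (≤-reflexive formula)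
               (≤-trans (+-monoʳ-≤ (pairedCoverage k) (multiplicity-singles {k} lo hi)) atMostTwice)

lemma3p5 : (m : ℕ) → 1 ≤ m →
    Σ (Almost5StarFactor (30 * m + 2) 2) λ F →
      ((d : ℕ) → 1 ≤ d → d ≤ 15 * m → 1 ≤ forwardDiffCount F d)
      × ((d : ℕ) → 1 ≤ d → d ≤ 15 * m → forwardDiffCount F d ≤ 2)
      × All (λ e → T (isForwardᵇ (30 * m + 2) e)) (edges F)
-- The construction needs no assumption on m; for m = 0 it is the single edge {0, 1}.
lemma3p5 m _ =
  F , (λ d 1≤d d≤n → proj₁ (forwardDiffCount-bounds 1≤d d≤n))
    , (λ d 1≤d d≤n → proj₂ (forwardDiffCount-bounds 1≤d d≤n))
    , all-forward
  where open StarFactor m
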